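{- For every $n \ge 3$, the $n$-gonal prism graph $C_n \,\square\, K_2$ is P2-win.
   Context: Trail Trap on a finite simple undirected graph $G$: Player 1 (P1) chooses a vertex, places a token on it and moves it along an incident edge $e$ to the other endpoint. Player 2 (P2) then places their own token on any vertex and moves it along an incident edge $f \neq e$. Thereafter the players alternate, starting with P1, each moving their own token from its current vertex along an unused edge (an edge not previously traversed, in either direction, by either player) to the adjacent vertex; vertices may be revisited and the two tokens may share a vertex. The first player unable to move loses. $G$ is P1-win if P1 has a winning strategy, and P2-win otherwise. $C_n$ is the cycle on $n$ vertices. The Cartesian product $G \,\square\, H$ has vertex set $V(G)\times V(H)$, with $(x,y)$ adjacent to $(u,v)$ iff either $x=u$ and $yv \in E(H)$, or $y=v$ and $xu \in E(G)$. -}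

module Defs where

open import Level using (0ℓ)
open import Data.Nat using (ℕ; zero; suc)
open import Data.Fin using (Fin; toℕ)
open import Data.Product using (_×_; _,_; ∃; ∃-syntax; Σ-syntax)
open import Data.Sum using (_⊎_)
open import Data.List using (List; []; _∷_)
open import Data.List.Membership.Propositional using (_∈_)
open import Relation.Binary.PropositionalEquality using (_≡_; _≢_)
open import Relation.Nullary using (¬_)

-- A graph: a vertex type and an adjacency relation (edges are unordered
-- pairs {x,y} with Adj x y; the graphs used below are finite and simple).
record Graph : Set₁ where
  field
    V   : Set
    Adj : V → V → Set
open Graph public

-- The edge {x,y} has already been traversed (in either direction),
-- given the list U of traversals (from , to) made so far.
Used : {V : Set} → List (V × V) → V → V → Set
Used U x y = ((x , y) ∈ U) ⊎ ((y , x) ∈ U)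

-- Game positions after the opening: (a , b , U) where a is the token of the
-- player to move, b the token of the other player, U the traversals so far.
-- MoverWins / MoverLoses: the player to move has / lacks a winning strategy.
-- (The game is finite, so this inductive characterisation is exactly the
-- existence of a winning strategy.)
mutual
  data MoverWins (G : Graph) : V G → V G → List (V G × V G) → Set where
    move : ∀ {a b U} (a' : V G) → Adj G a a' → ¬ Used U a a' →
           MoverLoses G b a' ((a , a') ∷ U) → MoverWins G a b U

  data MoverLoses (G : Graph) : V G → V G → List (V G × V G) → Set where
    stuck : ∀ {a b U} →
            ((a' : V G) → Adj G a a' → ¬ Used U a a' →
               MoverWins G b a' ((a , a') ∷ U)) →
            MoverLoses G a b U

-- P1 chooses v and traverses e = {v,w}; P2 then chooses any u and traverses
-- f = {u,u'} ≠ e; then P1 (at w) moves next.  P1-win: P1 has a winning strategy.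
P1Win : Graph → Set
P1Win G = ∃[ v ] ∃[ w ] (Adj G v w ×
            ((u u' : V G) → Adj G u u' → ¬ Used ((v , w) ∷ []) u u' →
              MoverWins G w u' ((u , u') ∷ (v , w) ∷ [])))

P2Win : Graph → Set
P2Win G = ¬ P1Win G

CycSucc : {n : ℕ} → Fin n → Fin n → Set
CycSucc {n} x y = (toℕ y ≡ suc (toℕ x)) ⊎ ((suc (toℕ x) ≡ n) × (toℕ y ≡ 0))

Cycle : ℕ → Graph
Cycle n = record { V = Fin n ; Adj = λ x y → CycSucc x y ⊎ CycSucc y x }

K2 : Graph
K2 = record { V = Fin 2 ; Adj = λ x y → x ≢ y }

_□_ : Graph → Graph → Graph
G □ H = record
  { V   = V G × V H
  ; Adj = λ { (x , y) (u , v) → ((x ≡ u) × Adj H y v) ⊎ ((y ≡ v) × Adj G x u) } }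

-- P2 answers every move by its image under an involutive automorphism σ of
-- the prism that reflects the cycle and swaps the two layers.  σ fixes no
-- vertex, so the reply uses a fresh edge unless P1 has just crossed a rung
-- {x, σ x} that σ maps to itself; these rungs lie on the reflection axis.
-- With two reflections available, σ can be chosen so that P1 does not start
-- on the axis.  Invariant: at an axis vertex x whose rung is unused, exactly
-- one cycle edge is used if a token stands on x or σ x, and both or neither
-- are used otherwise.  When P1 crosses such a rung onto P2's vertex, P2 leaves
-- along the remaining cycle edge and P1 is stuck.
module Submission where

open import Defs
open import Data.Nat using (ℕ; suc; _≤_; _<_; _∸_; _<?_; s≤s)
import Data.Nat.Properties as ℕₚ
open import Data.Bool using (Bool; false; true; not)
open import Data.Bool.Properties using (not-¬)
open import Data.Fin as Fin using (Fin; toℕ; fromℕ; fromℕ<; inject₁; opposite)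
import Data.Fin.Properties as Finₚ
open import Data.Product using (Σ; _×_; _,_; proj₁; proj₂; map; map₁; map₂)
open import Data.Product.Properties using (≡-dec)
open import Data.Sum using (_⊎_; inj₁; inj₂)
open import Data.List using (List; []; _∷_)
open import Data.List.Relation.Unary.Any using (here; there)
open import Data.Empty using (⊥; ⊥-elim)
open import Function using (_∘_)
open import Relation.Nullary using (¬_; yes; no)
open import Relation.Binary.Definitions using (DecidableEquality)
open import Relation.Binary.PropositionalEquality

module _ {A : Set} where

  used-sym : ∀ {W : List (A × A)} {x y} → Used W x y → Used W y x
  used-sym (inj₁ p) = inj₂ p
  used-sym (inj₂ p) = inj₁ p

  used-∷ : ∀ {W : List (A × A)} {p x y} → Used W x y → Used (p ∷ W) x y
  used-∷ (inj₁ m) = inj₁ (there m)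
  used-∷ (inj₂ m) = inj₂ (there m)

  used-head : ∀ {W : List (A × A)} {x y} → Used ((x , y) ∷ W) x y
  used-head = inj₁ (here refl)

  used-head˘ : ∀ {W : List (A × A)} {x y} → Used ((y , x) ∷ W) x y
  used-head˘ = inj₂ (here refl)

  used-∷-cases : ∀ {W : List (A × A)} {p q x y} → Used ((p , q) ∷ W) x y →
                 ((x ≡ p × y ≡ q) ⊎ (x ≡ q × y ≡ p)) ⊎ Used W x y
  used-∷-cases (inj₁ (here refl)) = inj₁ (inj₁ (refl , refl))
  used-∷-cases (inj₁ (there m))   = inj₂ (inj₁ m)
  used-∷-cases (inj₂ (here refl)) = inj₁ (inj₂ (refl , refl))
  used-∷-cases (inj₂ (there m))   = inj₂ (inj₂ m)

  used-∷-drop : ∀ {W : List (A × A)} {p q x y} → x ≢ p → x ≢ q →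
                Used ((p , q) ∷ W) x y → Used W x y
  used-∷-drop x≢p x≢q u with used-∷-cases u
  ... | inj₁ (inj₁ (x≡p , _)) = ⊥-elim (x≢p x≡p)
  ... | inj₁ (inj₂ (x≡q , _)) = ⊥-elim (x≢q x≡q)
  ... | inj₂ u′               = u′

  unused-[] : ∀ {x y : A} → ¬ Used [] x y
  unused-[] (inj₁ ())
  unused-[] (inj₂ ())

record PrismStructure (G : Graph) : Set where
  field
    _≟_             : DecidableEquality (V G)
    left right rung : V G → V G
    layer           : V G → Bool
    adj-cases       : ∀ {x y} → Adj G x y → y ≡ left x ⊎ y ≡ right x ⊎ y ≡ rung x
    adj-left        : ∀ x → Adj G x (left x)
    adj-right       : ∀ x → Adj G x (right x)
    adj-rung        : ∀ x → Adj G x (rung x)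
    right-left      : ∀ x → right (left x) ≡ x
    left-right      : ∀ x → left (right x) ≡ x
    rung-involutive : ∀ x → rung (rung x) ≡ x
    layer-left      : ∀ x → layer (left x) ≡ layer x
    layer-right     : ∀ x → layer (right x) ≡ layer x
    layer-rung      : ∀ x → layer (rung x) ≡ not (layer x)
    x≢right         : ∀ x → x ≢ right x
    left≢right      : ∀ x → left x ≢ right x

record Mirror {G : Graph} (P : PrismStructure G) : Set where
  open PrismStructure P
  field
    σ            : V G → V G
    σ-involutive : ∀ x → σ (σ x) ≡ x
    σ-left       : ∀ x → σ (left x) ≡ right (σ x)
    σ-rung       : ∀ x → σ (rung x) ≡ rung (σ x)
    layer-σ      : ∀ x → layer (σ x) ≡ not (layer x)

module MirrorStrategy {G : Graph} {P : PrismStructure G} (M : Mirror P) where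
  open PrismStructure P
  open Mirror M

  Traversals : Set
  Traversals = List (V G × V G)

  σ-right : ∀ x → σ (right x) ≡ left (σ x)
  σ-right x = begin
    σ (right x)                ≡⟨ left-right (σ (right x)) ⟨
    left (right (σ (right x))) ≡⟨ cong left (σ-left (right x)) ⟨
    left (σ (left (right x)))  ≡⟨ cong (left ∘ σ) (left-right x) ⟩
    left (σ x)                 ∎
    where open ≡-Reasoning

  σ-left-σ : ∀ x → σ (left (σ x)) ≡ right x
  σ-left-σ x = trans (σ-left (σ x)) (cong right (σ-involutive x))

  σ-right-σ : ∀ x → σ (right (σ x)) ≡ left x
  σ-right-σ x = trans (σ-right (σ x)) (cong left (σ-involutive x))

  ≢σ-comm : ∀ {x y} → x ≢ σ y → y ≢ σ x
  ≢σ-comm x≢σy y≡σx = x≢σy (sym (trans (cong σ y≡σx) (σ-involutive _)))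

  layers-differ : ∀ {x y} → layer x ≡ not (layer y) → x ≢ y
  layers-differ e refl = not-¬ refl e

  σ≢id : ∀ x → σ x ≢ x
  σ≢id x = layers-differ (layer-σ x)

  σ≢left : ∀ x → σ x ≢ left x
  σ≢left x = layers-differ (trans (layer-σ x) (cong not (sym (layer-left x))))

  σ≢right : ∀ x → σ x ≢ right x
  σ≢right x = layers-differ (trans (layer-σ x) (cong not (sym (layer-right x))))

  left-σ≢id : ∀ x → left (σ x) ≢ x
  left-σ≢id x = layers-differ (trans (layer-left (σ x)) (layer-σ x))

  right-σ≢id : ∀ x → right (σ x) ≢ x
  right-σ≢id x = layers-differ (trans (layer-right (σ x)) (layer-σ x))

  x≢left : ∀ x → x ≢ left x
  x≢left x x≡left = x≢right x (sym (trans (cong right x≡left) (right-left x)))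

  adj-irrefl : ∀ {x y} → Adj G x y → x ≢ y
  adj-irrefl {x} adj x≡y with adj-cases adj
  ... | inj₁ y≡left         = x≢left x (trans x≡y y≡left)
  ... | inj₂ (inj₁ y≡right) = x≢right x (trans x≡y y≡right)
  ... | inj₂ (inj₂ y≡rung)  = layers-differ (layer-rung x) (sym (trans x≡y y≡rung))

  σ-adj : ∀ {x y} → Adj G x y → Adj G (σ x) (σ y)
  σ-adj {x} adj with adj-cases adj
  ... | inj₁ refl        = subst (Adj G (σ x)) (sym (σ-left x)) (adj-right (σ x))
  ... | inj₂ (inj₁ refl) = subst (Adj G (σ x)) (sym (σ-right x)) (adj-left (σ x))
  ... | inj₂ (inj₂ refl) = subst (Adj G (σ x)) (sym (σ-rung x)) (adj-rung (σ x))

  OnAxis : V G → Set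
  OnAxis x = rung x ≡ σ x

  adj-σ⇒on-axis : ∀ {a a'} → Adj G a a' → a' ≡ σ a → OnAxis a
  adj-σ⇒on-axis {a} adj a'≡σa with adj-cases adj
  ... | inj₁ a'≡left         = ⊥-elim (σ≢left a (trans (sym a'≡σa) a'≡left))
  ... | inj₂ (inj₁ a'≡right) = ⊥-elim (σ≢right a (trans (sym a'≡σa) a'≡right))
  ... | inj₂ (inj₂ a'≡rung)  = trans (sym a'≡rung) a'≡σa

  rung-σ-on-axis : ∀ {x} → OnAxis x → rung (σ x) ≡ x
  rung-σ-on-axis {x} ax = trans (sym (σ-rung x)) (trans (cong σ ax) (σ-involutive x))

  σ-on-axis : ∀ {x} → OnAxis x → OnAxis (σ x)
  σ-on-axis {x} ax = trans (sym (σ-rung x)) (cong σ ax)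

  Symmetric : Traversals → Set
  Symmetric W = ∀ {x y} → Used W x y → Used W (σ x) (σ y)

  round : V G → V G → Traversals → Traversals
  round a a' W = (σ a , σ a') ∷ (a , a') ∷ W

  symmetric-[] : Symmetric []
  symmetric-[] u = ⊥-elim (unused-[] u)

  symmetric-round : ∀ {W a a'} → Symmetric W → Symmetric (round a a' W)
  symmetric-round sym-W u with used-∷-cases u
  ... | inj₁ (inj₁ (refl , refl)) = subst₂ (Used _) (sym (σ-involutive _)) (sym (σ-involutive _)) (used-∷ used-head)
  ... | inj₁ (inj₂ (refl , refl)) = subst₂ (Used _) (sym (σ-involutive _)) (sym (σ-involutive _)) (used-∷ used-head˘)
  ... | inj₂ u′ with used-∷-cases u′
  ...   | inj₁ (inj₁ (refl , refl)) = used-head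
  ...   | inj₁ (inj₂ (refl , refl)) = used-head˘
  ...   | inj₂ u″                   = used-∷ (used-∷ (sym-W u″))

  mirror-fresh : ∀ {W a a'} → Symmetric W → ¬ Used W a a' → a' ≢ σ a →
                 ¬ Used ((a , a') ∷ W) (σ a) (σ a')
  mirror-fresh sym-W fresh a'≢σa u with used-∷-cases u
  ... | inj₁ (inj₁ (σa≡a , _)) = σ≢id _ σa≡a
  ... | inj₁ (inj₂ (σa≡a' , _)) = a'≢σa (sym σa≡a')
  ... | inj₂ u′ = fresh (subst₂ (Used _) (σ-involutive _) (σ-involutive _) (sym-W u′))

  OneSideUsed : Traversals → V G → Set
  OneSideUsed W x = (Used W x (left x) × ¬ Used W x (right x))
                  ⊎ (¬ Used W x (left x) × Used W x (right x))

  SidesAgree : Traversals → V G → Set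
  SidesAgree W x = (Used W x (left x) → Used W x (right x))
                 × (Used W x (right x) → Used W x (left x))

  both-sides-agree : ∀ {W x} → Used W x (left x) → Used W x (right x) → SidesAgree W x
  both-sides-agree uL uR = (λ _ → uR) , (λ _ → uL)

  one-side-σ : ∀ {W x} → Symmetric W → OneSideUsed W (σ x) → OneSideUsed W x
  one-side-σ {W} {x} sym-W (inj₁ (uL , nR)) =
    inj₂ ( (λ u → nR (subst (Used W (σ x)) (σ-left x) (sym-W u)))
         , subst₂ (Used W) (σ-involutive x) (σ-left-σ x) (sym-W uL))
  one-side-σ {W} {x} sym-W (inj₂ (nL , uR)) =
    inj₁ ( subst₂ (Used W) (σ-involutive x) (σ-right-σ x) (sym-W uR)
         , (λ u → nL (subst (Used W (σ x)) (σ-right x) (sym-W u))))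

  all-used-stuck : ∀ {c b W} → Used W c (left c) → Used W c (right c) → Used W c (rung c) →
                   ¬ MoverWins G c b W
  all-used-stuck uL uR uT (move y adj fresh _) with adj-cases adj
  ... | inj₁ refl        = fresh uL
  ... | inj₂ (inj₁ refl) = fresh uR
  ... | inj₂ (inj₂ refl) = fresh uT

  -- a is the token of the player to move; the other token stands on σ a.
  record Guarded (W : Traversals) (a : V G) : Set where
    field
      symmetric : Symmetric W
      occupied  : ∀ x → OnAxis x → ¬ Used W x (rung x) → a ≡ x ⊎ a ≡ σ x → OneSideUsed W x
      vacant    : ∀ x → OnAxis x → ¬ Used W x (rung x) → a ≢ x → a ≢ σ x → SidesAgree W x

  guarded-start : ∀ {v} → ¬ OnAxis v → Guarded [] v
  guarded-start {v} off = record
    { symmetric = symmetric-[]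
    ; occupied  = occupied
    ; vacant    = λ _ _ _ _ _ → (λ u → ⊥-elim (unused-[] u)) , (λ u → ⊥-elim (unused-[] u))
    }
    where
    occupied : ∀ x → OnAxis x → ¬ Used [] x (rung x) → v ≡ x ⊎ v ≡ σ x → OneSideUsed [] x
    occupied x ax _ (inj₁ refl) = ⊥-elim (off ax)
    occupied x ax _ (inj₂ refl) = ⊥-elim (off (σ-on-axis ax))

  axis-rung-crossing-loses : ∀ {a W} → Guarded W a → OnAxis a → ¬ Used W a (σ a) →
    ¬ ((b' : V G) → Adj G (σ a) b' → ¬ Used ((a , σ a) ∷ W) (σ a) b' →
         MoverWins G (σ a) b' ((σ a , b') ∷ (a , σ a) ∷ W))
  axis-rung-crossing-loses {a} {W} g ax fresh replies =
    leave (Guarded.occupied g (σ a) (σ-on-axis ax) rung-fresh (inj₂ (sym (σ-involutive a))))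
    where
    rung-fresh : ¬ Used W (σ a) (rung (σ a))
    rung-fresh u = fresh (used-sym (subst (Used W (σ a)) (rung-σ-on-axis ax) u))
    rung-used : ∀ {t} → Used (t ∷ (a , σ a) ∷ W) (σ a) (rung (σ a))
    rung-used = used-∷ (subst (Used _ (σ a)) (sym (rung-σ-on-axis ax)) used-head˘)
    still-fresh : ∀ {b'} → b' ≢ a → ¬ Used W (σ a) b' → ¬ Used ((a , σ a) ∷ W) (σ a) b'
    still-fresh b'≢a nU u with used-∷-cases u
    ... | inj₁ (inj₁ (σa≡a , _)) = σ≢id a σa≡a
    ... | inj₁ (inj₂ (_ , b'≡a)) = b'≢a b'≡a
    ... | inj₂ u′                = nU u′
    leave : OneSideUsed W (σ a) → ⊥
    leave (inj₁ (uL , nR)) =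
      all-used-stuck (used-∷ (used-∷ uL)) used-head rung-used
        (replies (right (σ a)) (adj-right _) (still-fresh (right-σ≢id a) nR))
    leave (inj₂ (nL , uR)) =
      all-used-stuck used-head (used-∷ (used-∷ uR)) rung-used
        (replies (left (σ a)) (adj-left _) (still-fresh (left-σ≢id a) nL))

  sides-agree-σ : ∀ {W x} → Symmetric W → SidesAgree W (σ x) → SidesAgree W x
  sides-agree-σ {W} {x} sym-W (l⇒r , r⇒l) =
    (λ u → back (σ-left-σ x) (r⇒l (subst (Used W (σ x)) (σ-left x) (sym-W u))))
    , (λ u → back (σ-right-σ x) (l⇒r (subst (Used W (σ x)) (σ-right x) (sym-W u))))
    where
    back : ∀ {y z} → σ z ≡ y → Used W (σ x) z → Used W x y
    back σz≡y u = subst₂ (Used W) (σ-involutive x) σz≡y (sym-W u)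

  departure-sides-agree : ∀ {a a' W} → OnAxis a → OneSideUsed W a → Adj G a a' →
    ¬ Used W a a' → a' ≢ σ a → SidesAgree (round a a' W) a
  departure-sides-agree ax one adj fresh a'≢σa with adj-cases adj | one
  ... | inj₁ refl           | inj₁ (uL , _) = ⊥-elim (fresh uL)
  ... | inj₁ refl           | inj₂ (_ , uR) = both-sides-agree (used-∷ used-head) (used-∷ (used-∷ uR))
  ... | inj₂ (inj₁ refl)    | inj₁ (uL , _) = both-sides-agree (used-∷ (used-∷ uL)) (used-∷ used-head)
  ... | inj₂ (inj₁ refl)    | inj₂ (_ , uR) = ⊥-elim (fresh uR)
  ... | inj₂ (inj₂ a'≡rung) | _             = ⊥-elim (a'≢σa (trans a'≡rung ax))

  untouched-sides-agree : ∀ {a a' W x} → a ≢ x → a' ≢ x → a ≢ σ x → a' ≢ σ x →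
    SidesAgree W x → SidesAgree (round a a' W) x
  untouched-sides-agree {a} {a'} {W} {x} a≢x a'≢x a≢σx a'≢σx (l⇒r , r⇒l) =
    (λ u → lift (l⇒r (lower u))) , (λ u → lift (r⇒l (lower u)))
    where
    lift : ∀ {y} → Used W x y → Used (round a a' W) x y
    lift = used-∷ ∘ used-∷
    lower : ∀ {y} → Used (round a a' W) x y → Used W x y
    lower = used-∷-drop (a≢x ∘ sym) (a'≢x ∘ sym)
          ∘ used-∷-drop (≢σ-comm a≢σx) (≢σ-comm a'≢σx)

  arrival-one-side : ∀ {a a' W} → Guarded W a → Adj G a a' → ¬ Used W a a' → a' ≢ σ a →
    OnAxis a' → ¬ Used (round a a' W) a' (rung a') → OneSideUsed (round a a' W) a'
  arrival-one-side {a} {a'} {W} g adj fresh a'≢σa ax rung-fresh with adj-cases adj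
  ... | inj₂ (inj₂ refl) = ⊥-elim (≢σ-comm a'≢σa (trans (sym (rung-involutive a)) ax))
  ... | inj₁ refl = inj₂ (nL , uR)
    where
    before : SidesAgree W (left a)
    before = Guarded.vacant g (left a) ax (rung-fresh ∘ used-∷ ∘ used-∷)
               (adj-irrefl adj) (≢σ-comm a'≢σa)
    uR : Used (round a (left a) W) (left a) (right (left a))
    uR = subst (Used _ (left a)) (sym (right-left a)) (used-∷ used-head˘)
    nL : ¬ Used (round a (left a) W) (left a) (left (left a))
    nL u with used-∷-cases u
    ... | inj₁ (inj₁ (e , _)) = σ≢left a (sym e)
    ... | inj₁ (inj₂ (e , _)) = σ≢id (left a) (sym e)
    ... | inj₂ u′ with used-∷-cases u′
    ...   | inj₁ (inj₁ (e , _)) = x≢left a (sym e)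
    ...   | inj₁ (inj₂ (_ , e)) = left≢right a (trans (sym (right-left (left a))) (cong right e))
    ...   | inj₂ u″ = fresh (used-sym (subst (Used W (left a)) (right-left a) (proj₁ before u″)))
  ... | inj₂ (inj₁ refl) = inj₁ (uL , nR)
    where
    before : SidesAgree W (right a)
    before = Guarded.vacant g (right a) ax (rung-fresh ∘ used-∷ ∘ used-∷)
               (adj-irrefl adj) (≢σ-comm a'≢σa)
    uL : Used (round a (right a) W) (right a) (left (right a))
    uL = subst (Used _ (right a)) (sym (left-right a)) (used-∷ used-head˘)
    nR : ¬ Used (round a (right a) W) (right a) (right (right a))
    nR u with used-∷-cases u
    ... | inj₁ (inj₁ (e , _)) = σ≢right a (sym e)
    ... | inj₁ (inj₂ (e , _)) = σ≢id (right a) (sym e)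
    ... | inj₂ u′ with used-∷-cases u′
    ...   | inj₁ (inj₁ (e , _)) = x≢right a (sym e)
    ...   | inj₁ (inj₂ (_ , e)) = left≢right a (sym (trans (sym (left-right (right a))) (cong left e)))
    ...   | inj₂ u″ = fresh (used-sym (subst (Used W (right a)) (left-right a) (proj₂ before u″)))

  guarded-step : ∀ {a a' W} → Guarded W a → Adj G a a' → ¬ Used W a a' → a' ≢ σ a →
    Guarded (round a a' W) a'
  guarded-step {a} {a'} {W} g adj fresh a'≢σa = record
    { symmetric = symmetric-round sym-W
    ; occupied  = occupied
    ; vacant    = vacant
    }
    where
    open Guarded g renaming (symmetric to sym-W; occupied to occupied₀; vacant to vacant₀)
    occupied : ∀ x → OnAxis x → ¬ Used (round a a' W) x (rung x) → a' ≡ x ⊎ a' ≡ σ x →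
               OneSideUsed (round a a' W) x
    occupied x ax rung-fresh (inj₁ refl) = arrival-one-side g adj fresh a'≢σa ax rung-fresh
    occupied x ax rung-fresh (inj₂ refl) =
      one-side-σ (symmetric-round sym-W) (arrival-one-side g adj fresh a'≢σa (σ-on-axis ax) rung-fresh′)
      where
      rung-fresh′ : ¬ Used (round a (σ x) W) (σ x) (rung (σ x))
      rung-fresh′ u = rung-fresh (subst₂ (Used _) (σ-involutive x) (sym ax)
        (symmetric-round sym-W (subst (Used _ (σ x)) (rung-σ-on-axis ax) u)))
    vacant : ∀ x → OnAxis x → ¬ Used (round a a' W) x (rung x) → a' ≢ x → a' ≢ σ x →
             SidesAgree (round a a' W) x
    vacant x ax rung-fresh a'≢x a'≢σx with a ≟ x | a ≟ σ x
    ... | yes refl | _ =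
      departure-sides-agree ax (occupied₀ x ax (rung-fresh ∘ used-∷ ∘ used-∷) (inj₁ refl)) adj fresh a'≢σa
    ... | no _ | yes refl =
      sides-agree-σ (symmetric-round sym-W)
        (departure-sides-agree (σ-on-axis ax) (one-side-σ sym-W one′) adj fresh a'≢σa)
      where
      one′ : OneSideUsed W (σ (σ x))
      one′ = subst (OneSideUsed W) (sym (σ-involutive x))
               (occupied₀ x ax (rung-fresh ∘ used-∷ ∘ used-∷) (inj₂ refl))
    ... | no a≢x | no a≢σx =
      untouched-sides-agree a≢x a'≢x a≢σx a'≢σx (vacant₀ x ax (rung-fresh ∘ used-∷ ∘ used-∷) a≢x a≢σx)

  mirror-refutes : ∀ {a W} → Guarded W a → ¬ MoverWins G a (σ a) W
  mirror-refutes {a} g (move a' adj fresh (stuck replies)) with a' ≟ σ a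
  ... | yes refl  = axis-rung-crossing-loses g (adj-σ⇒on-axis adj refl) fresh replies
  ... | no a'≢σa  = mirror-refutes (guarded-step g adj fresh a'≢σa)
    (replies (σ a') (σ-adj adj) (mirror-fresh (Guarded.symmetric g) fresh a'≢σa))

  opening-refuted : ∀ {v w} → ¬ OnAxis v → Adj G v w →
    ¬ ((u u' : V G) → Adj G u u' → ¬ Used ((v , w) ∷ []) u u' →
         MoverWins G w u' ((u , u') ∷ (v , w) ∷ []))
  opening-refuted {v} {w} off adj replies =
    mirror-refutes (guarded-step (guarded-start off) adj unused-[] w≢σv)
      (replies (σ v) (σ w) (σ-adj adj) (mirror-fresh symmetric-[] unused-[] w≢σv))
    where
    w≢σv : w ≢ σ v
    w≢σv = off ∘ adj-σ⇒on-axis adj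

p2Win-by-mirrors : ∀ {G} (P : PrismStructure G) →
  (∀ v → Σ (Mirror P) λ M → ¬ MirrorStrategy.OnAxis M v) → P2Win G
p2Win-by-mirrors P off-axis (v , w , adj , replies) =
  MirrorStrategy.opening-refuted (proj₁ (off-axis v)) (proj₂ (off-axis v)) adj replies

module CyclePrism (m : ℕ) where

  n : ℕ
  n = suc (suc (suc m))

  next : Fin n → Fin n
  next i with suc (toℕ i) <? n
  ... | yes i+1<n = fromℕ< i+1<n
  ... | no _      = Fin.zero

  prev : Fin n → Fin n
  prev Fin.zero    = fromℕ (suc (suc m))
  prev (Fin.suc j) = inject₁ j

  CycSucc-next : ∀ (i : Fin n) → CycSucc i (next i)
  CycSucc-next i with suc (toℕ i) <? n
  ... | yes i+1<n = inj₁ (Finₚ.toℕ-fromℕ< i+1<n)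
  ... | no i+1≮n  = inj₂ (ℕₚ.≤-antisym (Finₚ.toℕ<n i) (ℕₚ.≮⇒≥ i+1≮n) , refl)

  CycSucc-prev : ∀ (i : Fin n) → CycSucc (prev i) i
  CycSucc-prev Fin.zero    = inj₂ (cong suc (Finₚ.toℕ-fromℕ (suc (suc m))) , refl)
  CycSucc-prev (Fin.suc j) = inj₁ (cong suc (sym (Finₚ.toℕ-inject₁ j)))

  CycSucc-functional : ∀ {i j j' : Fin n} → CycSucc i j → CycSucc i j' → j ≡ j'
  CycSucc-functional (inj₁ e) (inj₁ e') = Finₚ.toℕ-injective (trans e (sym e'))
  CycSucc-functional {j = j} (inj₁ e) (inj₂ (e' , _)) =
    ⊥-elim (ℕₚ.<-irrefl (trans e e') (Finₚ.toℕ<n j))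
  CycSucc-functional {j' = j'} (inj₂ (e , _)) (inj₁ e') =
    ⊥-elim (ℕₚ.<-irrefl (trans e' e) (Finₚ.toℕ<n j'))
  CycSucc-functional (inj₂ (_ , z)) (inj₂ (_ , z')) = Finₚ.toℕ-injective (trans z (sym z'))

  CycSucc-injective : ∀ {i i' j : Fin n} → CycSucc i j → CycSucc i' j → i ≡ i'
  CycSucc-injective (inj₁ e) (inj₁ e') =
    Finₚ.toℕ-injective (ℕₚ.suc-injective (trans (sym e) e'))
  CycSucc-injective (inj₁ e) (inj₂ (_ , z)) with () ← trans (sym e) z
  CycSucc-injective (inj₂ (_ , z)) (inj₁ e') with () ← trans (sym e') z
  CycSucc-injective (inj₂ (e , _)) (inj₂ (e' , _)) =
    Finₚ.toℕ-injective (ℕₚ.suc-injective (trans e (sym e')))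

  CycSucc⇒≡next : ∀ {i j : Fin n} → CycSucc i j → j ≡ next i
  CycSucc⇒≡next {i} c = CycSucc-functional c (CycSucc-next i)

  CycSucc⇒≡prev : ∀ {i j : Fin n} → CycSucc j i → j ≡ prev i
  CycSucc⇒≡prev {i} c = CycSucc-injective c (CycSucc-prev i)

  next-prev : ∀ (i : Fin n) → next (prev i) ≡ i
  next-prev i = sym (CycSucc⇒≡next (CycSucc-prev i))

  prev-next : ∀ (i : Fin n) → prev (next i) ≡ i
  prev-next i = sym (CycSucc⇒≡prev (CycSucc-next i))

  CycSucc-irrefl : ∀ {i : Fin n} → ¬ CycSucc i i
  CycSucc-irrefl (inj₁ e) = ℕₚ.1+n≢n (sym e)
  CycSucc-irrefl {i} (inj₂ (e , z)) with toℕ i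
  CycSucc-irrefl (inj₂ (() , refl)) | .0

  -- fails for two columns, where next = prev
  CycSucc-asym : ∀ {i j : Fin n} → CycSucc i j → ¬ CycSucc j i
  CycSucc-asym {i} {j} c c' with toℕ i | toℕ j
  CycSucc-asym (inj₁ refl) (inj₁ ()) | _ | _
  CycSucc-asym (inj₁ refl) (inj₂ (() , refl)) | _ | _
  CycSucc-asym (inj₂ (() , refl)) (inj₁ refl) | _ | _
  CycSucc-asym (inj₂ (_ , refl)) (inj₂ (() , _)) | _ | _

  i≢next : ∀ (i : Fin n) → i ≢ next i
  i≢next i e = CycSucc-irrefl (subst (CycSucc i) (sym e) (CycSucc-next i))

  prev≢id : ∀ (i : Fin n) → prev i ≢ i
  prev≢id i e = i≢next i (trans (sym (next-prev i)) (cong next e))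

  prev≢next : ∀ (i : Fin n) → prev i ≢ next i
  prev≢next i e = CycSucc-asym (CycSucc-prev i) (subst (CycSucc i) (sym e) (CycSucc-next i))

  CycSucc-opposite : ∀ {i j : Fin n} → CycSucc j i → CycSucc (opposite i) (opposite j)
  CycSucc-opposite {i} {j} (inj₁ i≡j+1) = inj₁ (begin
    toℕ (opposite j)            ≡⟨ Finₚ.opposite-prop j ⟩
    n ∸ suc (toℕ j)             ≡⟨ ℕₚ.+-∸-assoc 1 (subst (_< n) i≡j+1 (Finₚ.toℕ<n i)) ⟩
    suc (n ∸ suc (suc (toℕ j))) ≡⟨ cong (λ t → suc (n ∸ suc t)) i≡j+1 ⟨
    suc (n ∸ suc (toℕ i))       ≡⟨ cong suc (Finₚ.opposite-prop i) ⟨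
    suc (toℕ (opposite i))      ∎)
    where open ≡-Reasoning
  CycSucc-opposite {i} {j} (inj₂ (j+1≡n , i≡0)) =
    inj₂ ( cong suc (trans (Finₚ.opposite-prop i) (cong (λ t → n ∸ suc t) i≡0))
         , trans (Finₚ.opposite-prop j) (trans (cong (n ∸_) j+1≡n) (ℕₚ.n∸n≡0 n)))

  opposite-prev : ∀ (i : Fin n) → opposite (prev i) ≡ next (opposite i)
  opposite-prev i = CycSucc⇒≡next (CycSucc-opposite (CycSucc-prev i))

  record Reflection (ρ : Fin n → Fin n) : Set where
    field
      involutive : ∀ i → ρ (ρ i) ≡ i
      ρ-prev     : ∀ i → ρ (prev i) ≡ next (ρ i)

  opposite-reflection : Reflection opposite
  opposite-reflection = record
    { involutive = Finₚ.opposite-involutive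
    ; ρ-prev     = opposite-prev
    }

  prev-opposite-reflection : Reflection (prev ∘ opposite)
  prev-opposite-reflection = record
    { involutive = λ i → trans (cong prev (opposite-prev (opposite i)))
                          (trans (cong (prev ∘ next) (Finₚ.opposite-involutive i)) (prev-next i))
    ; ρ-prev     = λ i → trans (cong prev (opposite-prev i))
                          (trans (prev-next (opposite i)) (sym (next-prev (opposite i))))
    }

  opposite-moved-or-prev-opposite-moved : ∀ (i : Fin n) → opposite i ≢ i ⊎ prev (opposite i) ≢ i
  opposite-moved-or-prev-opposite-moved i with opposite i Finₚ.≟ i
  ... | no moved  = inj₁ moved
  ... | yes fixed = inj₂ (prev≢id i ∘ trans (cong prev (sym fixed)))

  level : Fin 2 → Bool
  level Fin.zero           = false
  level (Fin.suc Fin.zero) = true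

  level-opposite : ∀ s → level (opposite s) ≡ not (level s)
  level-opposite Fin.zero           = refl
  level-opposite (Fin.suc Fin.zero) = refl

  K2-other : ∀ {s t : Fin 2} → s ≢ t → t ≡ opposite s
  K2-other {Fin.zero}           {Fin.zero}           s≢t = ⊥-elim (s≢t refl)
  K2-other {Fin.zero}           {Fin.suc Fin.zero}   _   = refl
  K2-other {Fin.suc Fin.zero}   {Fin.zero}           _   = refl
  K2-other {Fin.suc Fin.zero}   {Fin.suc Fin.zero}   s≢t = ⊥-elim (s≢t refl)

  s≢opposite : ∀ (s : Fin 2) → s ≢ opposite s
  s≢opposite Fin.zero ()
  s≢opposite (Fin.suc Fin.zero) ()

  Prism : Graph
  Prism = Cycle n □ K2

  prism-adj-cases : ∀ {x y} → Adj Prism x y →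
    y ≡ map₁ prev x ⊎ y ≡ map₁ next x ⊎ y ≡ map₂ opposite x
  prism-adj-cases {i , s} (inj₁ (refl , s≢t))     = inj₂ (inj₂ (cong (i ,_) (K2-other s≢t)))
  prism-adj-cases {i , s} (inj₂ (refl , inj₁ c)) = inj₂ (inj₁ (cong (_, s) (CycSucc⇒≡next c)))
  prism-adj-cases {i , s} (inj₂ (refl , inj₂ c)) = inj₁ (cong (_, s) (CycSucc⇒≡prev c))

  prism : PrismStructure Prism
  prism = record
    { _≟_             = ≡-dec Finₚ._≟_ Finₚ._≟_
    ; left            = map₁ prev
    ; right           = map₁ next
    ; rung            = map₂ opposite
    ; layer           = level ∘ proj₂
    ; adj-cases       = prism-adj-cases
    ; adj-left        = λ (i , s) → inj₂ (refl , inj₂ (CycSucc-prev i))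
    ; adj-right       = λ (i , s) → inj₂ (refl , inj₁ (CycSucc-next i))
    ; adj-rung        = λ (i , s) → inj₁ (refl , s≢opposite s)
    ; right-left      = λ (i , s) → cong (_, s) (next-prev i)
    ; left-right      = λ (i , s) → cong (_, s) (prev-next i)
    ; rung-involutive = λ (i , s) → cong (i ,_) (Finₚ.opposite-involutive s)
    ; layer-left      = λ _ → refl
    ; layer-right     = λ _ → refl
    ; layer-rung      = λ (_ , s) → level-opposite s
    ; x≢right         = λ (i , _) → i≢next i ∘ cong proj₁
    ; left≢right      = λ (i , _) → prev≢next i ∘ cong proj₁
    }

  mirror : ∀ {ρ} → Reflection ρ → Mirror prism
  mirror {ρ} r = record
    { σ            = map ρ opposite
    ; σ-involutive = λ (i , s) → cong₂ _,_ (involutive i) (Finₚ.opposite-involutive s)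
    ; σ-left       = λ (i , s) → cong (_, opposite s) (ρ-prev i)
    ; σ-rung       = λ _ → refl
    ; layer-σ      = λ (_ , s) → level-opposite s
    }
    where open Reflection r

  on-axis⇒fixed : ∀ {ρ} (r : Reflection ρ) ((i , s) : Fin n × Fin 2) →
    MirrorStrategy.OnAxis (mirror r) (i , s) → ρ i ≡ i
  on-axis⇒fixed r _ = sym ∘ cong proj₁

  off-axis-mirror : ∀ v → Σ (Mirror prism) λ M → ¬ MirrorStrategy.OnAxis M v
  off-axis-mirror (i , s) with opposite-moved-or-prev-opposite-moved i
  ... | inj₁ moved = mirror opposite-reflection , moved ∘ on-axis⇒fixed opposite-reflection (i , s)
  ... | inj₂ moved = mirror prev-opposite-reflection , moved ∘ on-axis⇒fixed prev-opposite-reflection (i , s)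

proposition3p5 : (n : ℕ) → 3 ≤ n → P2Win (Cycle n □ K2)
proposition3p5 (suc (suc (suc m))) (s≤s (s≤s (s≤s _))) =
  p2Win-by-mirrors (CyclePrism.prism m) (CyclePrism.off-axis-mirror m)
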